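{- Let $G$ be a finite, simple, connected graph. Then $$\tfrac{1}{2}\max\{\dim(G),{\rm edim}(G)\} \le \tfrac{1}{2}\phi(G) \le {\rm mdim}(S(G)) \le {\rm mdim}(G).$$
   Context: For a connected graph $H$, $d_H$ is the usual distance; for a vertex $v$ and an edge $e=ww'$, $d_H(e,v)=\min\{d_H(w,v),d_H(w',v)\}$. A vertex $v$ resolves two elements $x,y\in V(H)\cup E(H)$ if $d_H(x,v)\ne d_H(y,v)$. A set $S\subseteq V(H)$ is a resolving set (resp. edge resolving set, mixed resolving set) if every two distinct vertices (resp. every two distinct edges, every two distinct elements of $V(H)\cup E(H)$) are resolved by some vertex of $S$. $\dim(H)$, ${\rm edim}(H)$, ${\rm mdim}(H)$ denote the minimum cardinalities of a resolving set, an edge resolving set, and a mixed resolving set, respectively; a metric basis is a resolving set of cardinality $\dim(H)$. The subdivision graph $S(G)$ is obtained from $G$ by subdividing every edge once; for $e\in E(G)$, $v_e$ denotes the new vertex on $e$. For a metric basis $X$ of $S(G)$, let $\phi(X)=\{u\in V(G): u\in X \text{ or } u \text{ is adjacent in } S(G) \text{ to a subdivision vertex belonging to } X\}$, and $\phi(G)=\min\{|\phi(X)| : X \text{ is a metric basis of } S(G)\}$. -}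

module Defs where

open import Data.Nat using (ℕ; zero; suc; _≤_; _⊓_)
open import Data.Bool using (Bool; T)
open import Data.Fin using (Fin) renaming (_<_ to _<ᶠ_)
open import Data.List using (List; length)
open import Data.List.Membership.Propositional using (_∈_)
open import Data.List.Relation.Unary.Unique.Propositional using (Unique)
open import Data.Product using (Σ; ∃; _×_; _,_)
open import Data.Sum using (_⊎_; inj₁; inj₂)
open import Data.Empty using (⊥)
open import Relation.Nullary using (¬_)
open import Relation.Binary.PropositionalEquality using (_≡_; _≢_)

-- Generic metric notions for a graph on a vertex type V with adjacency _~_.
-- Vertex sets are duplicate-free lists; cardinality = length.

module Metric {V : Set} (_~_ : V → V → Set) where

  data Walk : V → V → ℕ → Set where
    here : ∀ {u} → Walk u u 0
    step : ∀ {u w v k} → u ~ w → Walk w v k → Walk u v (suc k)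

  Dist : V → V → ℕ → Set
  Dist u v k = Walk u v k × (∀ {j} → Walk u v j → k ≤ j)

  Connected : Set
  Connected = ∀ u v → ∃ λ k → Walk u v k

  -- an edge ww' (given as an oriented pair; compared as an unordered pair)
  Edge : Set
  Edge = Σ (V × V) λ p → Data.Product.proj₁ p ~ Data.Product.proj₂ p

  SameEdge : Edge → Edge → Set
  SameEdge ((a , b) , _) ((a' , b') , _) = (a ≡ a' × b ≡ b') ⊎ (a ≡ b' × b ≡ a')

  DistE : Edge → V → ℕ → Set
  DistE ((a , b) , _) v k =
    Σ ℕ λ ka → Σ ℕ λ kb → Dist a v ka × Dist b v kb × k ≡ ka ⊓ kb

  Elem : Set
  Elem = V ⊎ Edge

  SameElem : Elem → Elem → Set
  SameElem (inj₁ x) (inj₁ y) = x ≡ y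
  SameElem (inj₂ e) (inj₂ f) = SameEdge e f
  SameElem _        _        = ⊥

  DistEl : Elem → V → ℕ → Set
  DistEl (inj₁ x) v k = Dist x v k
  DistEl (inj₂ e) v k = DistE e v k

  Resolves : V → Elem → Elem → Set
  Resolves v x y = ∀ k l → DistEl x v k → DistEl y v l → k ≢ l

  ResolvedBy : List V → Elem → Elem → Set
  ResolvedBy S x y = Σ V λ v → v ∈ S × Resolves v x y

  ResolvingSet : List V → Set
  ResolvingSet S = ∀ (x y : V) → x ≢ y → ResolvedBy S (inj₁ x) (inj₁ y)

  EdgeResolvingSet : List V → Set
  EdgeResolvingSet S = ∀ (e f : Edge) → ¬ SameEdge e f → ResolvedBy S (inj₂ e) (inj₂ f)

  MixedResolvingSet : List V → Set
  MixedResolvingSet S = ∀ (x y : Elem) → ¬ SameElem x y → ResolvedBy S x y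

  IsMinCard : (List V → Set) → ℕ → Set
  IsMinCard P k =
    (Σ (List V) λ S → Unique S × P S × length S ≡ k)
    × (∀ S → Unique S → P S → k ≤ length S)

  IsDim IsEdim IsMdim : ℕ → Set
  IsDim  = IsMinCard ResolvingSet
  IsEdim = IsMinCard EdgeResolvingSet
  IsMdim = IsMinCard MixedResolvingSet

  IsMetricBasis : List V → Set
  IsMetricBasis X =
    Unique X × ResolvingSet X × (∀ Y → Unique Y → ResolvingSet Y → length X ≤ length Y)

-- Finite simple graphs on vertex set Fin n (Bool adjacency: no multi-edges)

record SimpleGraph (n : ℕ) : Set where
  field
    adj    : Fin n → Fin n → Bool
    sym    : ∀ {u v} → T (adj u v) → T (adj v u)
    irrefl : ∀ {u} → ¬ T (adj u u)

module _ {n : ℕ} (G : SimpleGraph n) where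
  open SimpleGraph G

  Adj : Fin n → Fin n → Set
  Adj u v = T (adj u v)

  -- canonical (unordered) edges of G: pairs u < v that are adjacent
  CEdge : Set
  CEdge = Σ (Fin n × Fin n) λ p → (Data.Product.proj₁ p <ᶠ Data.Product.proj₂ p) × Adj (Data.Product.proj₁ p) (Data.Product.proj₂ p)

  -- vertices of the subdivision graph S(G): original vertices and v_e for e ∈ E(G)
  SV : Set
  SV = Fin n ⊎ CEdge

  EndOf : Fin n → CEdge → Set
  EndOf x ((u , v) , _) = x ≡ u ⊎ x ≡ v

  SAdj : SV → SV → Set
  SAdj (inj₁ x) (inj₂ e) = EndOf x e
  SAdj (inj₂ e) (inj₁ x) = EndOf x e
  SAdj _        _        = ⊥

  module MG = Metric Adj
  module MS = Metric SAdj

  ConnectedG : Set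
  ConnectedG = MG.Connected

  InPhi : List SV → Fin n → Set
  InPhi X u = (inj₁ u ∈ X) ⊎ (Σ CEdge λ e → inj₂ e ∈ X × EndOf u e)

  PhiCard : List SV → ℕ → Set
  PhiCard X c = Σ (List (Fin n)) λ L →
    Unique L × length L ≡ c × (∀ u → (u ∈ L → InPhi X u) × (InPhi X u → u ∈ L))

  IsPhi : ℕ → Set
  IsPhi p =
    (Σ (List SV) λ X → MS.IsMetricBasis X × PhiCard X p)
    × (∀ X c → MS.IsMetricBasis X → PhiCard X c → p ≤ c)

-- Distances in S(G) are explicit in terms of distances in G: an original vertex
-- x is at distance 2 d(x,w) from an original vertex w and a subdivision vertex
-- v_e at distance 2 d(e,w) + 1, while a subdivision vertex v_g sees x at
-- distance 2 d(x,g) + 1 and v_e at distance 2 d(e,g) + 2 (0 if e = g).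
-- Hence a subdivision vertex v_g of a metric basis X of S(G) can only separate
-- what one of the two endpoints of g separates in G, so φ(X) resolves both the
-- vertices and the edges of G, giving max(dim, edim) ≤ φ(G); and |φ(X)| ≤ 2|X|
-- while a mixed resolving set of S(G) is resolving, giving φ(G) ≤ 2 mdim(S(G)).
-- Conversely the distance from an original vertex w to an element of S(G) is
-- 2 d(x,w), 2 d(e,w) + 1, or, for the half edge x v_e, either 2 d(x,w) or
-- 2 d(e,w) + 1 according as d(x,w) = d(e,w) or d(e,w) + 1; a parity argument
-- then shows that a mixed resolving set of G resolves all elements of S(G).
module Submission where

open import Defs
open import Data.Bool using (if_then_else_)
open import Data.Bool.Properties using (T-irrelevant; T?)
open import Data.Empty using (⊥; ⊥-elim)
open import Data.Fin using (Fin) renaming (_<_ to _<ᶠ_)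
import Data.Fin.Properties as Fin
open import Data.List using (List; []; _∷_; length; map; _++_)
open import Data.List.Membership.Propositional using (_∈_)
open import Data.List.Membership.Propositional.Properties using (∈-∃++; ∈-map⁺)
open import Data.List.Properties using (length-map; length-++)
open import Data.List.Relation.Binary.Subset.Propositional using (_⊆_)
open import Data.List.Relation.Unary.All using (lookup)
open import Data.List.Relation.Unary.AllPairs using (_∷_)
open import Data.List.Relation.Unary.Any using (here; there)
open import Data.List.Relation.Unary.Unique.Propositional using (Unique)
import Data.List.Relation.Unary.Unique.Propositional.Properties as Unique
open import Data.Nat using (ℕ; zero; suc; _≤_; _⊓_; _⊔_; _*_; _+_; z≤n; s≤s; s≤s⁻¹; _≟_)
open import Data.Nat.Properties
open import Algebra.Properties.CommutativeSemigroup ⊓-commutativeSemigroup using (interchange)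
open import Data.Product using (Σ; ∃; _×_; _,_; proj₁; proj₂; uncurry)
import Data.Product.Properties as Product
open import Data.Sum using (_⊎_; inj₁; inj₂)
open import Data.Sum.Properties using (inj₁-injective; inj₂-injective)
open import Data.Unit using (⊤; tt)
open import Function using (_∘_)
open import Relation.Binary using (tri<; tri≈; tri>)
open import Relation.Binary.PropositionalEquality
open import Relation.Nullary using (¬_; Dec; yes; no)
open import Relation.Nullary.Decidable using (_×-dec_; ⌊_⌋)
open import Relation.Unary using (Decidable)

least-witness : ∀ {P : ℕ → Set} → Decidable P → ∀ {m} K → m ≤ K → P m →
                ∃ λ k → P k × (∀ {j} → P j → k ≤ j)
least-witness P? zero z≤n P0 = 0 , P0 , λ _ → z≤n
least-witness P? (suc K) m≤1+K Pm with anyUpTo? P? (suc K)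
... | yes (i , s≤s i≤K , Pi) = least-witness P? K i≤K Pi
... | no none = _ , Pm , λ Pj → ≮⇒≥ (λ j<m → none (_ , <-≤-trans j<m m≤1+K , Pj))

⊓≡0 : ∀ a b → a ⊓ b ≡ 0 → a ≡ 0 ⊎ b ≡ 0
⊓≡0 zero    b       _ = inj₁ refl
⊓≡0 (suc a) zero    _ = inj₂ refl

≢-either : ∀ {a b c d : ℕ} → (a ≡ b → c ≡ d → ⊥) → a ≢ b ⊎ c ≢ d
≢-either {a} {b} {c} {d} ¬both with a ≟ b
... | no a≢b = inj₁ a≢b
... | yes a≡b = inj₂ (¬both a≡b)

suc-⊓-self : ∀ k → suc k ⊓ k ≡ k
suc-⊓-self k = m≥n⇒m⊓n≡n (n≤1+n k)

2*-injective : ∀ {a b} → 2 * a ≡ 2 * b → a ≡ b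
2*-injective {a} {b} = *-cancelˡ-≡ a b 2

2*-mono-suc : ∀ {a b} → a ≤ suc b → 2 * a ≤ 2 + 2 * b
2*-mono-suc {a} {b} a≤1+b = ≤-trans (*-monoʳ-≤ 2 a≤1+b) (≤-reflexive (*-suc 2 b))

2*≡suc : ∀ k m → 2 * k ≡ suc m → ∃ λ k′ → k ≡ suc k′ × m ≡ suc (2 * k′)
2*≡suc (suc k′) m e = k′ , refl , sym (suc-injective (trans (sym (*-suc 2 k′)) e))

-- The distance to a half edge x v_e from an original vertex, where δ = d(e,w)
-- and d = d(x,w).
⊓-even-odd : ∀ {δ d} → δ ≤ d → d ≤ suc δ →
  (d ≡ δ × 2 * d ⊓ suc (2 * δ) ≡ 2 * d) ⊎ (d ≡ suc δ × 2 * d ⊓ suc (2 * δ) ≡ suc (2 * δ))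
⊓-even-odd {δ} δ≤d d≤1+δ with m≤n⇒m<n∨m≡n δ≤d
... | inj₂ refl = inj₁ (refl , m≤n⇒m⊓n≡m (n≤1+n _))
... | inj₁ δ<d with ≤-antisym d≤1+δ δ<d
... | refl = inj₂ (refl , m≥n⇒m⊓n≡n (≤-trans (n≤1+n _) (≤-reflexive (sym (*-suc 2 δ)))))

Unique-length-mono : ∀ {A : Set} {xs ys : List A} → Unique xs → xs ⊆ ys → length xs ≤ length ys
Unique-length-mono {xs = []} _ _ = z≤n
Unique-length-mono {xs = x ∷ xs} (x∉xs ∷ uxs) xs⊆ys with ∈-∃++ (xs⊆ys (here refl))
... | ys₁ , ys₂ , refl = begin
    suc (length xs)            ≤⟨ s≤s (Unique-length-mono uxs (λ u∈xs → drop (xs⊆ys (there u∈xs)) (x≢ u∈xs))) ⟩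
    suc (length (ys₁ ++ ys₂))  ≡⟨ cong suc (length-++ ys₁) ⟩
    suc (length ys₁ + length ys₂) ≡⟨ sym (+-suc (length ys₁) (length ys₂)) ⟩
    length ys₁ + length (x ∷ ys₂) ≡⟨ sym (length-++ ys₁) ⟩
    length (ys₁ ++ x ∷ ys₂)    ∎
  where
  open ≤-Reasoning
  x≢ : ∀ {u} → u ∈ xs → u ≢ x
  x≢ u∈xs = lookup x∉xs u∈xs ∘ sym
  drop : ∀ {u} {zs₁ zs₂} → u ∈ zs₁ ++ x ∷ zs₂ → u ≢ x → u ∈ zs₁ ++ zs₂
  drop {zs₁ = []} (here refl) u≢x = ⊥-elim (u≢x refl)
  drop {zs₁ = []} (there m) _ = m
  drop {zs₁ = _ ∷ _} (here refl) _ = here refl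
  drop {zs₁ = _ ∷ _} (there m) u≢x = there (drop m u≢x)

module WalkDistance {V : Set} (_~_ : V → V → Set) where
  open Metric _~_

  Dist-unique : ∀ {u v k l} → Dist u v k → Dist u v l → k ≡ l
  Dist-unique (w , min) (w′ , min′) = ≤-antisym (min w′) (min′ w)

  mixed⇒resolving : ∀ {S} → MixedResolvingSet S → ResolvingSet S
  mixed⇒resolving mix x y = mix (inj₁ x) (inj₁ y)

  record DistanceLabelling (t : V) (f : V → ℕ) : Set where
    field
      zero-at-target : f t ≡ 0
      zero⇒target    : ∀ u → f u ≡ 0 → u ≡ t
      descend        : ∀ u m → f u ≡ suc m → ∃ λ w → u ~ w × f w ≡ m
      lipschitz      : ∀ u w → u ~ w → f u ≤ suc (f w)

  labelling⇒Dist : ∀ {t f} → DistanceLabelling t f → ∀ u → Dist u t (f u)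
  labelling⇒Dist {t} {f} L u = walk (f u) u refl , lower
    where
    open DistanceLabelling L
    walk : ∀ k u → f u ≡ k → Walk u t k
    walk zero u e with zero⇒target u e
    ... | refl = here
    walk (suc k) u e with descend u k e
    ... | w , u~w , e′ = step u~w (walk k w e′)
    lower : ∀ {u j} → Walk u t j → f u ≤ j
    lower here = ≤-reflexive zero-at-target
    lower (step u~w r) = ≤-trans (lipschitz _ _ u~w) (s≤s (lower r))

  module ViaDistance (δ : V → V → ℕ) (δ-Dist : ∀ u v → Dist u v (δ u v)) where

    δᴱ : Elem → V → ℕ
    δᴱ (inj₁ x) v = δ x v
    δᴱ (inj₂ ((a , b) , _)) v = δ a v ⊓ δ b v

    DistEl-δᴱ : ∀ z v → DistEl z v (δᴱ z v)
    DistEl-δᴱ (inj₁ x) v = δ-Dist x v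
    DistEl-δᴱ (inj₂ ((a , b) , _)) v = δ a v , δ b v , δ-Dist a v , δ-Dist b v , refl

    DistEl-unique : ∀ z v {k} → DistEl z v k → k ≡ δᴱ z v
    DistEl-unique (inj₁ x) v d = Dist-unique d (δ-Dist x v)
    DistEl-unique (inj₂ ((a , b) , _)) v (_ , _ , da , db , refl) =
      cong₂ _⊓_ (Dist-unique da (δ-Dist a v)) (Dist-unique db (δ-Dist b v))

    ≢⇒Resolves : ∀ v z z′ → δᴱ z v ≢ δᴱ z′ v → Resolves v z z′
    ≢⇒Resolves v z z′ ne k l dk dl k≡l =
      ne (trans (sym (DistEl-unique z v dk)) (trans k≡l (DistEl-unique z′ v dl)))

    Resolves⇒≢ : ∀ v z z′ → Resolves v z z′ → δᴱ z v ≢ δᴱ z′ v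
    Resolves⇒≢ v z z′ r = r _ _ (DistEl-δᴱ z v) (DistEl-δᴱ z′ v)

module CanonicalEdge {n : ℕ} (G : SimpleGraph n) where
  open SimpleGraph G using (irrefl) renaming (sym to adj-sym)

  endˡ endʳ : CEdge G → Fin n
  endˡ e = proj₁ (proj₁ e)
  endʳ e = proj₂ (proj₁ e)

  endˡ<endʳ : (e : CEdge G) → endˡ e <ᶠ endʳ e
  endˡ<endʳ e = proj₁ (proj₂ e)

  CEdge-≡ : (e f : CEdge G) → proj₁ e ≡ proj₁ f → e ≡ f
  CEdge-≡ ((a , b) , lt , p) ((.a , .b) , lt′ , p′) refl
    rewrite <-irrelevant lt lt′ | T-irrelevant p p′ = refl

  _≟ᴱ_ : (e f : CEdge G) → Dec (proj₁ e ≡ proj₁ f)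
  e ≟ᴱ f = Product.≡-dec Fin._≟_ Fin._≟_ (proj₁ e) (proj₁ f)

  toEdge : CEdge G → Metric.Edge (Adj G)
  toEdge e = proj₁ e , proj₂ (proj₂ e)

  ≢⇒¬SameEdge : ∀ e f → e ≢ f → ¬ Metric.SameEdge (Adj G) (toEdge e) (toEdge f)
  ≢⇒¬SameEdge e f e≢f (inj₁ (refl , refl)) = e≢f (CEdge-≡ e f refl)
  ≢⇒¬SameEdge e f e≢f (inj₂ (refl , refl)) = <-asym (endˡ<endʳ e) (endˡ<endʳ f)

  ends⇒≡ : ∀ e {c c′} → EndOf G c e → EndOf G c′ e → c <ᶠ c′ → proj₁ e ≡ (c , c′)
  ends⇒≡ e (inj₁ refl) (inj₂ refl) _ = refl
  ends⇒≡ e (inj₁ refl) (inj₁ refl) c<c = ⊥-elim (<-irrefl refl c<c)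
  ends⇒≡ e (inj₂ refl) (inj₂ refl) c<c = ⊥-elim (<-irrefl refl c<c)
  ends⇒≡ e (inj₂ refl) (inj₁ refl) c′<c = ⊥-elim (<-asym (endˡ<endʳ e) c′<c)

  otherEnd : ∀ {y} e → EndOf G y e → ∃ λ a → ∀ (h : Fin n → ℕ) → h (endˡ e) ⊓ h (endʳ e) ≡ h y ⊓ h a
  otherEnd e (inj₁ refl) = endʳ e , λ h → refl
  otherEnd e (inj₂ refl) = endˡ e , λ h → ⊓-comm _ _

  toCEdge : ∀ x y → Adj G x y → CEdge G
  toCEdge x y a with Fin.<-cmp x y
  ... | tri< x<y _ _ = (x , y) , x<y , a
  ... | tri≈ _ refl _ = ⊥-elim (irrefl a)
  ... | tri> _ _ y<x = (y , x) , y<x , adj-sym a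

  toCEdge-endˡ : ∀ x y a → EndOf G x (toCEdge x y a)
  toCEdge-endˡ x y a with Fin.<-cmp x y
  ... | tri< _ _ _ = inj₁ refl
  ... | tri≈ _ refl _ = ⊥-elim (irrefl a)
  ... | tri> _ _ _ = inj₂ refl

  toCEdge-endʳ : ∀ x y a → EndOf G y (toCEdge x y a)
  toCEdge-endʳ x y a with Fin.<-cmp x y
  ... | tri< _ _ _ = inj₂ refl
  ... | tri≈ _ refl _ = ⊥-elim (irrefl a)
  ... | tri> _ _ _ = inj₁ refl

  toCEdge-ends : ∀ x y a {z} → EndOf G z (toCEdge x y a) → z ≡ x ⊎ z ≡ y
  toCEdge-ends x y a p with Fin.<-cmp x y
  toCEdge-ends x y a p        | tri< _ _ _ = p
  toCEdge-ends x y a p        | tri≈ _ refl _ = ⊥-elim (irrefl a)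
  toCEdge-ends x y a (inj₁ q) | tri> _ _ _ = inj₂ q
  toCEdge-ends x y a (inj₂ q) | tri> _ _ _ = inj₁ q

  toCEdge-⊓ : ∀ x y a (h : Fin n → ℕ) →
    h (endˡ (toCEdge x y a)) ⊓ h (endʳ (toCEdge x y a)) ≡ h x ⊓ h y
  toCEdge-⊓ x y a h with Fin.<-cmp x y
  ... | tri< _ _ _ = refl
  ... | tri≈ _ refl _ = ⊥-elim (irrefl a)
  ... | tri> _ _ _ = ⊓-comm (h y) (h x)

  ≢toCEdge : ∀ x y a x′ y′ a′ → ¬ Metric.SameEdge (Adj G) ((x , y) , a) ((x′ , y′) , a′) →
             toCEdge x y a ≢ toCEdge x′ y′ a′
  ≢toCEdge x y a x′ y′ a′ ¬same e≡e′
    with toCEdge-ends x′ y′ a′ (subst (EndOf G x) e≡e′ (toCEdge-endˡ x y a))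
       | toCEdge-ends x′ y′ a′ (subst (EndOf G y) e≡e′ (toCEdge-endʳ x y a))
  ... | inj₁ refl | inj₁ refl = irrefl a
  ... | inj₁ refl | inj₂ refl = ¬same (inj₁ (refl , refl))
  ... | inj₂ refl | inj₁ refl = ¬same (inj₂ (refl , refl))
  ... | inj₂ refl | inj₂ refl = irrefl a

  Lipschitz : (Fin n → ℕ) → Set
  Lipschitz h = ∀ {u v} → Adj G u v → h u ≤ suc (h v)

  minOn : (Fin n → ℕ) → CEdge G → ℕ
  minOn h e = h (endˡ e) ⊓ h (endʳ e)

  minOn-sandwich : ∀ {h} → Lipschitz h → ∀ {x} e → EndOf G x e →
                   minOn h e ≤ h x × h x ≤ suc (minOn h e)
  minOn-sandwich lip e (inj₁ refl) = m⊓n≤m _ _ , ⊓-glb (n≤1+n _) (lip (proj₂ (proj₂ e)))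
  minOn-sandwich lip e (inj₂ refl) = m⊓n≤n _ _ , ⊓-glb (lip (adj-sym (proj₂ (proj₂ e)))) (n≤1+n _)

module GraphDistance {n : ℕ} (G : SimpleGraph n) (conn : ConnectedG G) where
  open SimpleGraph G using (adj)
  open Metric (Adj G) using (Walk; Dist; here; step)
  open CanonicalEdge G

  walk? : ∀ k u v → Dec (Walk u v k)
  walk? zero u v with u Fin.≟ v
  ... | yes refl = yes here
  ... | no u≢v = no λ { here → u≢v refl }
  walk? (suc k) u v with Fin.any? (λ w → T? (adj u w) ×-dec walk? k w v)
  ... | yes (w , a , r) = yes (step a r)
  ... | no none = no λ { (step a r) → none (_ , a , r) }

  -- abstract: only dG-Dist is ever used, and unfolding the search is costly
  abstract
    dG : Fin n → Fin n → ℕ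
    dG u v = proj₁ (least-witness (λ k → walk? k u v) _ ≤-refl (proj₂ (conn u v)))

    dG-Dist : ∀ u v → Dist u v (dG u v)
    dG-Dist u v = proj₂ (least-witness (λ k → walk? k u v) _ ≤-refl (proj₂ (conn u v)))

  dG-refl : ∀ v → dG v v ≡ 0
  dG-refl v = n≤0⇒n≡0 (proj₂ (dG-Dist v v) here)

  dG≡0⇒≡ : ∀ u v → dG u v ≡ 0 → u ≡ v
  dG≡0⇒≡ u v e with subst (Walk u v) e (proj₁ (dG-Dist u v))
  ... | here = refl

  dG-lipschitz : ∀ w → Lipschitz (λ x → dG x w)
  dG-lipschitz w {u} {v} a = proj₂ (dG-Dist u w) (step a (proj₁ (dG-Dist v w)))

  dG-descend : ∀ u v m → dG u v ≡ suc m → ∃ λ w → Adj G u w × dG w v ≡ m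
  dG-descend u v m e with subst (Walk u v) e (proj₁ (dG-Dist u v))
  ... | step {w = w} a r =
    w , a , ≤-antisym (proj₂ (dG-Dist w v) r)
                      (s≤s⁻¹ (subst (_≤ suc (dG w v)) e (dG-lipschitz v a)))

  dEV : CEdge G → Fin n → ℕ
  dEV e w = minOn (λ x → dG x w) e

  dVE : Fin n → CEdge G → ℕ
  dVE x g = dG x (endˡ g) ⊓ dG x (endʳ g)

  dEE : CEdge G → CEdge G → ℕ
  dEE e g = minOn (λ x → dVE x g) e

  dVE-lipschitz : ∀ g → Lipschitz (λ x → dVE x g)
  dVE-lipschitz g a = ⊓-mono-≤ (dG-lipschitz (endˡ g) a) (dG-lipschitz (endʳ g) a)

  EndOf⇒dVE≡0 : ∀ {x} g → EndOf G x g → dVE x g ≡ 0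
  EndOf⇒dVE≡0 g (inj₁ refl) rewrite dG-refl (endˡ g) = refl
  EndOf⇒dVE≡0 g (inj₂ refl) rewrite dG-refl (endʳ g) = ⊓-zeroʳ (dG (endʳ g) (endˡ g))

  dVE≡0⇒EndOf : ∀ x g → dVE x g ≡ 0 → EndOf G x g
  dVE≡0⇒EndOf x g e with ⊓≡0 (dG x (endˡ g)) (dG x (endʳ g)) e
  ... | inj₁ z = inj₁ (dG≡0⇒≡ _ _ z)
  ... | inj₂ z = inj₂ (dG≡0⇒≡ _ _ z)

  dVE-descend : ∀ x g k → dVE x g ≡ suc k → ∃ λ y → Adj G x y × dVE y g ≡ k
  dVE-descend x g k e with nearEnd (⊓-sel (dG x (endˡ g)) (dG x (endʳ g)))
    where
    nearEnd : dVE x g ≡ dG x (endˡ g) ⊎ dVE x g ≡ dG x (endʳ g) →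
              ∃ λ c → dG x c ≡ suc k × (∀ y → dVE y g ≤ dG y c)
    nearEnd (inj₁ l) = endˡ g , trans (sym l) e , λ y → m⊓n≤m _ _
    nearEnd (inj₂ r) = endʳ g , trans (sym r) e , λ y → m⊓n≤n _ _
  ... | c , x→c , below with dG-descend x c k x→c
  ... | y , a , y→c =
    y , a , ≤-antisym (≤-trans (below y) (≤-reflexive y→c))
                      (s≤s⁻¹ (subst (_≤ suc (dVE y g)) e (dVE-lipschitz g a)))

  end⇒⊓≡0 : ∀ a b p {c} → EndOf G c (toCEdge a b p) → dG a c ⊓ dG b c ≡ 0
  end⇒⊓≡0 a b p q with toCEdge-ends a b p q
  ... | inj₁ refl rewrite dG-refl a = refl
  ... | inj₂ refl rewrite dG-refl b = ⊓-zeroʳ (dG a b)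

  ⊓≡0⇒end : ∀ a b p c → dG a c ⊓ dG b c ≡ 0 → EndOf G c (toCEdge a b p)
  ⊓≡0⇒end a b p c q with ⊓≡0 (dG a c) (dG b c) q
  ... | inj₁ z with dG≡0⇒≡ a c z
  ...   | refl = toCEdge-endˡ a b p
  ⊓≡0⇒end a b p c q | inj₂ z with dG≡0⇒≡ b c z
  ...   | refl = toCEdge-endʳ a b p

  toCEdge-same-ends : ∀ g a b p a′ b′ p′ → proj₁ (toCEdge a b p) ≡ proj₁ g →
    dG a (endˡ g) ⊓ dG b (endˡ g) ≡ dG a′ (endˡ g) ⊓ dG b′ (endˡ g) →
    dG a (endʳ g) ⊓ dG b (endʳ g) ≡ dG a′ (endʳ g) ⊓ dG b′ (endʳ g) →
    proj₁ (toCEdge a′ b′ p′) ≡ proj₁ g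
  toCEdge-same-ends g a b p a′ b′ p′ e≡g eqˡ eqʳ =
    ends⇒≡ (toCEdge a′ b′ p′) (transfer eqˡ (inj₁ refl)) (transfer eqʳ (inj₂ refl)) (endˡ<endʳ g)
    where
    transfer : ∀ {c} → dG a c ⊓ dG b c ≡ dG a′ c ⊓ dG b′ c → EndOf G c g → EndOf G c (toCEdge a′ b′ p′)
    transfer eq c∈g = ⊓≡0⇒end a′ b′ p′ _
      (trans (sym eq) (end⇒⊓≡0 a b p (subst (EndOf G _) (sym (CEdge-≡ (toCEdge a b p) g e≡g)) c∈g)))

  dEE-toCEdge : ∀ g a b p → dEE (toCEdge a b p) g ≡
                (dG a (endˡ g) ⊓ dG b (endˡ g)) ⊓ (dG a (endʳ g) ⊓ dG b (endʳ g))
  dEE-toCEdge g a b p = trans (toCEdge-⊓ a b p (λ x → dVE x g)) (interchange _ _ _ _)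

module SubdivisionDistance {n : ℕ} (G : SimpleGraph n) (conn : ConnectedG G) where
  open CanonicalEdge G
  open GraphDistance G conn
  open WalkDistance (SAdj G) using (DistanceLabelling; labelling⇒Dist)

  toVertex : Fin n → SV G → ℕ
  toVertex w (inj₁ x) = 2 * dG x w
  toVertex w (inj₂ e) = suc (2 * dEV e w)

  toSubdivision : CEdge G → SV G → ℕ
  toSubdivision g (inj₁ x) = suc (2 * dVE x g)
  toSubdivision g (inj₂ e) = if ⌊ e ≟ᴱ g ⌋ then 0 else 2 + 2 * dEE e g

  toVertex-labelling : ∀ w → DistanceLabelling (inj₁ w) (toVertex w)
  toVertex-labelling w = record
    { zero-at-target = cong (2 *_) (dG-refl w)
    ; zero⇒target    = zero⇒target
    ; descend        = descend
    ; lipschitz      = lipschitz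
    }
    where
    zero⇒target : ∀ u → toVertex w u ≡ 0 → u ≡ inj₁ w
    zero⇒target (inj₁ x) e = cong inj₁ (dG≡0⇒≡ x w (2*-injective e))
    descend : ∀ u m → toVertex w u ≡ suc m → ∃ λ v → SAdj G u v × toVertex w v ≡ m
    descend (inj₁ x) m e with 2*≡suc (dG x w) m e
    ... | k , x→w , refl with dG-descend x w k x→w
    ... | y , a , y→w = inj₂ (toCEdge x y a) , toCEdge-endˡ x y a ,
          cong (suc ∘ (2 *_)) (begin
            dEV (toCEdge x y a) w ≡⟨ toCEdge-⊓ x y a (λ z → dG z w) ⟩
            dG x w ⊓ dG y w       ≡⟨ cong₂ _⊓_ x→w y→w ⟩
            suc k ⊓ k             ≡⟨ suc-⊓-self k ⟩
            k                     ∎)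
      where open ≡-Reasoning
    descend (inj₂ e) m e′ with ⊓-sel (dG (endˡ e) w) (dG (endʳ e) w)
    ... | inj₁ l = inj₁ (endˡ e) , inj₁ refl , trans (cong (2 *_) (sym l)) (suc-injective e′)
    ... | inj₂ r = inj₁ (endʳ e) , inj₂ refl , trans (cong (2 *_) (sym r)) (suc-injective e′)
    lipschitz : ∀ u v → SAdj G u v → toVertex w u ≤ suc (toVertex w v)
    lipschitz (inj₁ x) (inj₂ e) p = 2*-mono-suc (proj₂ (minOn-sandwich (dG-lipschitz w) e p))
    lipschitz (inj₂ e) (inj₁ x) p = s≤s (*-monoʳ-≤ 2 (proj₁ (minOn-sandwich (dG-lipschitz w) e p)))

  toSubdivision-labelling : ∀ g → DistanceLabelling (inj₂ g) (toSubdivision g)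
  toSubdivision-labelling g = record
    { zero-at-target = zero-at-target
    ; zero⇒target    = zero⇒target
    ; descend        = descend
    ; lipschitz      = lipschitz
    }
    where
    zero-at-target : toSubdivision g (inj₂ g) ≡ 0
    zero-at-target with g ≟ᴱ g
    ... | yes _ = refl
    ... | no g≢g = ⊥-elim (g≢g refl)
    zero⇒target : ∀ u → toSubdivision g u ≡ 0 → u ≡ inj₂ g
    zero⇒target (inj₂ e) z with e ≟ᴱ g
    ... | yes e≡g = cong inj₂ (CEdge-≡ e g e≡g)
    descend : ∀ u m → toSubdivision g u ≡ suc m → ∃ λ v → SAdj G u v × toSubdivision g v ≡ m
    descend (inj₁ x) m e with dVE x g in x→g
    ... | zero = inj₂ g , dVE≡0⇒EndOf x g x→g , trans zero-at-target (suc-injective e)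
    ... | suc k with dVE-descend x g k x→g
    ...   | y , a , y→g = inj₂ (toCEdge x y a) , toCEdge-endˡ x y a , away (toCEdge x y a ≟ᴱ g)
      where
      open ≡-Reasoning
      away : (d : Dec (proj₁ (toCEdge x y a) ≡ proj₁ g)) →
             (if ⌊ d ⌋ then 0 else 2 + 2 * dEE (toCEdge x y a) g) ≡ m
      away (yes same) with trans (sym (EndOf⇒dVE≡0 g
                          (subst (EndOf G x) (CEdge-≡ (toCEdge x y a) g same) (toCEdge-endˡ x y a)))) x→g
      ... | ()
      away (no _) = begin
        2 + 2 * dEE (toCEdge x y a) g ≡⟨ cong (λ q → 2 + 2 * q) (toCEdge-⊓ x y a (λ z → dVE z g)) ⟩
        2 + 2 * (dVE x g ⊓ dVE y g)   ≡⟨ cong (λ q → 2 + 2 * q) (cong₂ _⊓_ x→g y→g) ⟩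
        2 + 2 * (suc k ⊓ k)           ≡⟨ cong (λ q → 2 + 2 * q) (suc-⊓-self k) ⟩
        2 + 2 * k                     ≡⟨ sym (*-suc 2 k) ⟩
        2 * suc k                     ≡⟨ suc-injective e ⟩
        m                             ∎
    descend (inj₂ e) m e′ with e ≟ᴱ g
    ... | no _ with ⊓-sel (dVE (endˡ e) g) (dVE (endʳ e) g)
    ...   | inj₁ l = inj₁ (endˡ e) , inj₁ refl , trans (cong (suc ∘ (2 *_)) (sym l)) (suc-injective e′)
    ...   | inj₂ r = inj₁ (endʳ e) , inj₂ refl , trans (cong (suc ∘ (2 *_)) (sym r)) (suc-injective e′)
    lipschitz : ∀ u v → SAdj G u v → toSubdivision g u ≤ suc (toSubdivision g v)
    lipschitz (inj₁ x) (inj₂ e) p with e ≟ᴱ g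
    ... | yes same rewrite EndOf⇒dVE≡0 g (subst (EndOf G x) (CEdge-≡ e g same) p) = ≤-refl
    ... | no _ = s≤s (2*-mono-suc (proj₂ (minOn-sandwich (dVE-lipschitz g) e p)))
    lipschitz (inj₂ e) (inj₁ x) p with e ≟ᴱ g
    ... | yes _ = z≤n
    ... | no _ = s≤s (s≤s (*-monoʳ-≤ 2 (proj₁ (minOn-sandwich (dVE-lipschitz g) e p))))

  dS : SV G → SV G → ℕ
  dS u (inj₁ w) = toVertex w u
  dS u (inj₂ g) = toSubdivision g u

  dS-Dist : ∀ u t → Metric.Dist (SAdj G) u t (dS u t)
  dS-Dist u (inj₁ w) = labelling⇒Dist (toVertex-labelling w) u
  dS-Dist u (inj₂ g) = labelling⇒Dist (toSubdivision-labelling g) u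

  toSubdivision-toCEdge : ∀ g a b p a′ b′ p′ →
    dG a (endˡ g) ⊓ dG b (endˡ g) ≡ dG a′ (endˡ g) ⊓ dG b′ (endˡ g) →
    dG a (endʳ g) ⊓ dG b (endʳ g) ≡ dG a′ (endʳ g) ⊓ dG b′ (endʳ g) →
    toSubdivision g (inj₂ (toCEdge a b p)) ≡ toSubdivision g (inj₂ (toCEdge a′ b′ p′))
  toSubdivision-toCEdge g a b p a′ b′ p′ eqˡ eqʳ
    with toCEdge a b p ≟ᴱ g | toCEdge a′ b′ p′ ≟ᴱ g
  ... | yes _ | yes _ = refl
  ... | yes e≡g | no e′≢g = ⊥-elim (e′≢g (toCEdge-same-ends g a b p a′ b′ p′ e≡g eqˡ eqʳ))
  ... | no e≢g | yes e′≡g = ⊥-elim (e≢g (toCEdge-same-ends g a′ b′ p′ a b p e′≡g (sym eqˡ) (sym eqʳ)))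
  ... | no _ | no _ = cong (λ q → 2 + 2 * q)
    (trans (dEE-toCEdge g a b p) (trans (cong₂ _⊓_ eqˡ eqʳ) (sym (dEE-toCEdge g a′ b′ p′))))

module PhiResolving {n : ℕ} (G : SimpleGraph n) (conn : ConnectedG G)
                    {X : List (SV G)} (resX : Metric.ResolvingSet (SAdj G) X)
                    {L : List (Fin n)} (φX⊆L : ∀ u → InPhi G X u → u ∈ L) where
  open Metric (Adj G) using (ResolvedBy; ResolvingSet; EdgeResolvingSet)
  open CanonicalEdge G
  open GraphDistance G conn
  open SubdivisionDistance G conn
  module Gd = WalkDistance.ViaDistance (Adj G) dG dG-Dist
  module Sd = WalkDistance.ViaDistance (SAdj G) dS dS-Dist

  resolvedByVertex : ∀ {w} → inj₁ w ∈ X → ∀ z z′ → Gd.δᴱ z w ≢ Gd.δᴱ z′ w → ResolvedBy L z z′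
  resolvedByVertex {w} w∈X z z′ ne = w , φX⊆L w (inj₁ w∈X) , Gd.≢⇒Resolves w z z′ ne

  resolvedByEnd : ∀ {g} → inj₂ g ∈ X → ∀ z z′ →
    Gd.δᴱ z (endˡ g) ≢ Gd.δᴱ z′ (endˡ g) ⊎ Gd.δᴱ z (endʳ g) ≢ Gd.δᴱ z′ (endʳ g) → ResolvedBy L z z′
  resolvedByEnd {g} g∈X z z′ (inj₁ ne) = endˡ g , φX⊆L _ (inj₂ (g , g∈X , inj₁ refl)) , Gd.≢⇒Resolves _ z z′ ne
  resolvedByEnd {g} g∈X z z′ (inj₂ ne) = endʳ g , φX⊆L _ (inj₂ (g , g∈X , inj₂ refl)) , Gd.≢⇒Resolves _ z z′ ne

  φ-resolving : ResolvingSet L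
  φ-resolving x y x≢y with resX (inj₁ x) (inj₁ y) (x≢y ∘ inj₁-injective)
  ... | inj₁ w , w∈X , r = resolvedByVertex w∈X (inj₁ x) (inj₁ y)
        (Sd.Resolves⇒≢ _ (inj₁ (inj₁ x)) (inj₁ (inj₁ y)) r ∘ cong (2 *_))
  ... | inj₂ g , g∈X , r = resolvedByEnd g∈X (inj₁ x) (inj₁ y) (≢-either λ eqˡ eqʳ →
        Sd.Resolves⇒≢ _ (inj₁ (inj₁ x)) (inj₁ (inj₁ y)) r (cong (suc ∘ (2 *_)) (cong₂ _⊓_ eqˡ eqʳ)))

  φ-edgeResolving : EdgeResolvingSet L
  φ-edgeResolving ε@((a , b) , p) ε′@((a′ , b′) , p′) ¬same
    with resX (inj₂ (toCEdge a b p)) (inj₂ (toCEdge a′ b′ p′))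
              (≢toCEdge a b p a′ b′ p′ ¬same ∘ inj₂-injective)
  ... | inj₁ w , w∈X , r = resolvedByVertex w∈X (inj₂ ε) (inj₂ ε′) λ eq →
        Sd.Resolves⇒≢ _ (inj₁ (inj₂ (toCEdge a b p))) (inj₁ (inj₂ (toCEdge a′ b′ p′))) r
          (cong (suc ∘ (2 *_)) (trans (toCEdge-⊓ a b p _) (trans eq (sym (toCEdge-⊓ a′ b′ p′ _)))))
  ... | inj₂ g , g∈X , r = resolvedByEnd g∈X (inj₂ ε) (inj₂ ε′) (≢-either λ eqˡ eqʳ →
        Sd.Resolves⇒≢ _ (inj₁ (inj₂ (toCEdge a b p))) (inj₁ (inj₂ (toCEdge a′ b′ p′))) r
          (toSubdivision-toCEdge g a b p a′ b′ p′ eqˡ eqʳ))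

module Endpoints {n : ℕ} (G : SimpleGraph n) where
  open CanonicalEdge G

  endpoints : List (SV G) → List (Fin n)
  endpoints [] = []
  endpoints (inj₁ u ∷ X) = u ∷ endpoints X
  endpoints (inj₂ e ∷ X) = endˡ e ∷ endʳ e ∷ endpoints X

  length-endpoints : ∀ X → length (endpoints X) ≤ 2 * length X
  length-endpoints [] = z≤n
  length-endpoints (inj₁ u ∷ X) =
    ≤-trans (s≤s (length-endpoints X)) (≤-trans (n≤1+n _) (≤-reflexive (sym (*-suc 2 (length X)))))
  length-endpoints (inj₂ e ∷ X) =
    ≤-trans (s≤s (s≤s (length-endpoints X))) (≤-reflexive (sym (*-suc 2 (length X))))

  InPhi⇒∈endpoints : ∀ X {u} → InPhi G X u → u ∈ endpoints X
  InPhi⇒∈endpoints (inj₁ v ∷ X) (inj₁ (here refl)) = here refl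
  InPhi⇒∈endpoints (inj₁ v ∷ X) (inj₁ (there m)) = there (InPhi⇒∈endpoints X (inj₁ m))
  InPhi⇒∈endpoints (inj₂ e ∷ X) (inj₁ (there m)) = there (there (InPhi⇒∈endpoints X (inj₁ m)))
  InPhi⇒∈endpoints (inj₂ e ∷ X) (inj₂ (.e , here refl , inj₁ refl)) = here refl
  InPhi⇒∈endpoints (inj₂ e ∷ X) (inj₂ (.e , here refl , inj₂ refl)) = there (here refl)
  InPhi⇒∈endpoints (inj₁ v ∷ X) (inj₂ (f , there m , q)) = there (InPhi⇒∈endpoints X (inj₂ (f , m , q)))
  InPhi⇒∈endpoints (inj₂ e ∷ X) (inj₂ (f , there m , q)) =
    there (there (InPhi⇒∈endpoints X (inj₂ (f , m , q))))

module MixedLift {n : ℕ} (G : SimpleGraph n) (conn : ConnectedG G)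
                 {S : List (Fin n)} (mixS : Metric.MixedResolvingSet (Adj G) S) where
  open Metric (Adj G) using (SameElem)
  open CanonicalEdge G
  open GraphDistance G conn
  open SubdivisionDistance G conn
  module Gd = WalkDistance.ViaDistance (Adj G) dG dG-Dist
  module Sd = WalkDistance.ViaDistance (SAdj G) dS dS-Dist

  data Element : Set where
    vertex      : Fin n → Element
    subdivision : CEdge G → Element
    half        : (x : Fin n) (e : CEdge G) → EndOf G x e → Element

  halfEdge : Metric.Edge (SAdj G) → Σ (Fin n) λ x → Σ (CEdge G) (EndOf G x)
  halfEdge ((inj₁ x , inj₂ e) , p) = x , e , p
  halfEdge ((inj₂ e , inj₁ x) , p) = x , e , p
  halfEdge ((inj₁ _ , inj₁ _) , ())
  halfEdge ((inj₂ _ , inj₂ _) , ())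

  halfEdge-injective : ∀ ε ε′ → proj₁ (halfEdge ε) ≡ proj₁ (halfEdge ε′) →
    proj₁ (proj₂ (halfEdge ε)) ≡ proj₁ (proj₂ (halfEdge ε′)) → Metric.SameEdge (SAdj G) ε ε′
  halfEdge-injective ((inj₁ _ , inj₁ _) , ()) _
  halfEdge-injective ((inj₂ _ , inj₂ _) , ()) _
  halfEdge-injective _ ((inj₁ _ , inj₁ _) , ())
  halfEdge-injective _ ((inj₂ _ , inj₂ _) , ())
  halfEdge-injective ((inj₁ _ , inj₂ _) , _) ((inj₁ _ , inj₂ _) , _) refl refl = inj₁ (refl , refl)
  halfEdge-injective ((inj₁ _ , inj₂ _) , _) ((inj₂ _ , inj₁ _) , _) refl refl = inj₂ (refl , refl)
  halfEdge-injective ((inj₂ _ , inj₁ _) , _) ((inj₁ _ , inj₂ _) , _) refl refl = inj₂ (refl , refl)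
  halfEdge-injective ((inj₂ _ , inj₁ _) , _) ((inj₂ _ , inj₁ _) , _) refl refl = inj₁ (refl , refl)

  classify : Metric.Elem (SAdj G) → Element
  classify (inj₁ (inj₁ x)) = vertex x
  classify (inj₁ (inj₂ e)) = subdivision e
  classify (inj₂ ε) = let (x , e , p) = halfEdge ε in half x e p

  Distinct : Element → Element → Set
  Distinct (vertex x) (vertex y) = x ≢ y
  Distinct (subdivision e) (subdivision f) = e ≢ f
  Distinct (half x e _) (half y f _) = ¬ (x ≡ y × e ≡ f)
  Distinct _ _ = ⊤

  distinct : ∀ z z′ → ¬ Metric.SameElem (SAdj G) z z′ → Distinct (classify z) (classify z′)
  distinct (inj₁ (inj₁ x)) (inj₁ (inj₁ y)) ¬same = ¬same ∘ cong inj₁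
  distinct (inj₁ (inj₁ x)) (inj₁ (inj₂ f)) _ = tt
  distinct (inj₁ (inj₁ x)) (inj₂ ε′) _ = tt
  distinct (inj₁ (inj₂ e)) (inj₁ (inj₁ y)) _ = tt
  distinct (inj₁ (inj₂ e)) (inj₁ (inj₂ f)) ¬same = ¬same ∘ cong inj₂
  distinct (inj₁ (inj₂ e)) (inj₂ ε′) _ = tt
  distinct (inj₂ ε) (inj₁ (inj₁ y)) _ = tt
  distinct (inj₂ ε) (inj₁ (inj₂ f)) _ = tt
  distinct (inj₂ ε) (inj₂ ε′) ¬same (x≡y , e≡f) = ¬same (halfEdge-injective ε ε′ x≡y e≡f)

  distanceFrom : Element → Fin n → ℕ
  distanceFrom (vertex x) w = 2 * dG x w
  distanceFrom (subdivision e) w = suc (2 * dEV e w)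
  distanceFrom (half x e _) w = 2 * dG x w ⊓ suc (2 * dEV e w)

  distanceFrom-classify : ∀ z w → Sd.δᴱ z (inj₁ w) ≡ distanceFrom (classify z) w
  distanceFrom-classify (inj₁ (inj₁ x)) w = refl
  distanceFrom-classify (inj₁ (inj₂ e)) w = refl
  distanceFrom-classify (inj₂ ((inj₁ x , inj₂ e) , _)) w = refl
  distanceFrom-classify (inj₂ ((inj₂ e , inj₁ x) , _)) w = ⊓-comm _ _
  distanceFrom-classify (inj₂ ((inj₁ _ , inj₁ _) , ())) w
  distanceFrom-classify (inj₂ ((inj₂ _ , inj₂ _) , ())) w

  HalfDistance : ∀ {x} e → EndOf G x e → Fin n → Set
  HalfDistance {x} e p w =
    (dG x w ≡ dEV e w × distanceFrom (half x e p) w ≡ 2 * dG x w) ⊎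
    (dG x w ≡ suc (dEV e w) × distanceFrom (half x e p) w ≡ suc (2 * dEV e w))

  half-distance : ∀ {x} e (p : EndOf G x e) w → HalfDistance e p w
  half-distance e p w = uncurry ⊓-even-odd (minOn-sandwich (dG-lipschitz w) e p)

  record Separated (k k′ : Element) : Set where
    constructor separatedAt
    field
      {witness} : Fin n
      witness∈S : witness ∈ S
      differ    : distanceFrom k witness ≢ distanceFrom k′ witness

  Separated-sym : ∀ {k k′} → Separated k k′ → Separated k′ k
  Separated-sym (separatedAt w∈S ne) = separatedAt w∈S (ne ∘ sym)

  separatedVia : ∀ g g′ {k k′} → ¬ SameElem g g′ →
    (∀ w → Gd.δᴱ g w ≢ Gd.δᴱ g′ w → distanceFrom k w ≢ distanceFrom k′ w) → Separated k k′
  separatedVia g g′ ¬same transfer with mixS g g′ ¬same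
  ... | w , w∈S , r = separatedAt w∈S (transfer w (Gd.Resolves⇒≢ w g g′ r))

  separate-vertex-half : ∀ x y e (p : EndOf G y e) → Separated (vertex x) (half y e p)
  separate-vertex-half x y e p with x Fin.≟ y
  ... | no x≢y = separatedVia (inj₁ x) (inj₁ y) x≢y λ w ne eq → case (half-distance e p w) ne eq
    where
    case : ∀ {w} → HalfDistance e p w → dG x w ≢ dG y w → distanceFrom (vertex x) w ≢ distanceFrom (half y e p) w
    case (inj₁ (_ , h)) ne eq = ne (2*-injective (trans eq h))
    case {w} (inj₂ (_ , h)) ne eq = even≢odd (dG x w) (dEV e w) (trans eq h)
  ... | yes refl = separatedVia (inj₁ x) (inj₂ (toEdge e)) (λ ()) λ w ne eq → case (half-distance e p w) ne eq
    where
    case : ∀ {w} → HalfDistance e p w → dG x w ≢ dEV e w → distanceFrom (vertex x) w ≢ distanceFrom (half x e p) w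
    case (inj₁ (d≡δ , _)) ne eq = ne d≡δ
    case {w} (inj₂ (_ , h)) ne eq = even≢odd (dG x w) (dEV e w) (trans eq h)

  separate-subdivision-half : ∀ f y e (p : EndOf G y e) → Separated (subdivision f) (half y e p)
  separate-subdivision-half f y e p with f ≟ᴱ e
  ... | no f≢e = separatedVia (inj₂ (toEdge f)) (inj₂ (toEdge e))
                   (≢⇒¬SameEdge f e (f≢e ∘ cong proj₁)) λ w ne eq → case (half-distance e p w) ne eq
    where
    case : ∀ {w} → HalfDistance e p w → dEV f w ≢ dEV e w → distanceFrom (subdivision f) w ≢ distanceFrom (half y e p) w
    case {w} (inj₁ (_ , h)) ne eq = even≢odd (dG y w) (dEV f w) (sym (trans eq h))
    case (inj₂ (_ , h)) ne eq = ne (2*-injective (suc-injective (trans eq h)))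
  ... | yes same with CEdge-≡ f e same | otherEnd e p
  ...   | refl | a , δ≡ = separatedVia (inj₁ a) (inj₂ (toEdge e)) (λ ()) λ w ne eq → case (half-distance e p w) ne eq
    where
    -- in the odd case d(y,w) > d(e,w), so d(e,w) is attained at the other end a
    case : ∀ {w} → HalfDistance e p w → dG a w ≢ dEV e w → distanceFrom (subdivision e) w ≢ distanceFrom (half y e p) w
    case {w} (inj₁ (_ , h)) ne eq = even≢odd (dG y w) (dEV e w) (sym (trans eq h))
    case {w} (inj₂ (d≡1+δ , _)) ne eq with ⊓-sel (dG y w) (dG a w)
    ... | inj₁ s = 1+n≢n (trans (sym d≡1+δ) (sym (trans (δ≡ (λ z → dG z w)) s)))
    ... | inj₂ s = ne (sym (trans (δ≡ (λ z → dG z w)) s))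

  separate-half-half : ∀ x e (p : EndOf G x e) y f (q : EndOf G y f) →
                       ¬ (x ≡ y × e ≡ f) → Separated (half x e p) (half y f q)
  separate-half-half x e p y f q ¬same with x Fin.≟ y
  ... | no x≢y = separatedVia (inj₁ x) (inj₁ y) x≢y λ w ne eq → case (half-distance e p w) (half-distance f q w) ne eq
    where
    case : ∀ {w} → HalfDistance e p w → HalfDistance f q w → dG x w ≢ dG y w → distanceFrom (half x e p) w ≢ distanceFrom (half y f q) w
    case (inj₁ (_ , h)) (inj₁ (_ , h′)) ne eq = ne (2*-injective (trans (sym h) (trans eq h′)))
    case {w} (inj₁ (_ , h)) (inj₂ (_ , h′)) ne eq = even≢odd (dG x w) (dEV f w) (trans (sym h) (trans eq h′))
    case {w} (inj₂ (_ , h)) (inj₁ (_ , h′)) ne eq = even≢odd (dG y w) (dEV e w) (sym (trans (sym h) (trans eq h′)))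
    case (inj₂ (d , h)) (inj₂ (d′ , h′)) ne eq =
      ne (trans d (trans (cong suc (2*-injective (suc-injective (trans (sym h) (trans eq h′))))) (sym d′)))
  ... | yes refl = separatedVia (inj₂ (toEdge e)) (inj₂ (toEdge f))
                     (≢⇒¬SameEdge e f (λ e≡f → ¬same (refl , e≡f))) λ w ne eq →
                     case (half-distance e p w) (half-distance f q w) ne eq
    where
    case : ∀ {w} → HalfDistance e p w → HalfDistance f q w → dEV e w ≢ dEV f w → distanceFrom (half x e p) w ≢ distanceFrom (half x f q) w
    case (inj₁ (d , _)) (inj₁ (d′ , _)) ne eq = ne (trans (sym d) d′)
    case {w} (inj₁ (_ , h)) (inj₂ (_ , h′)) ne eq = even≢odd (dG x w) (dEV f w) (trans (sym h) (trans eq h′))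
    case {w} (inj₂ (_ , h)) (inj₁ (_ , h′)) ne eq = even≢odd (dG x w) (dEV e w) (sym (trans (sym h) (trans eq h′)))
    case (inj₂ (_ , h)) (inj₂ (_ , h′)) ne eq = ne (2*-injective (suc-injective (trans (sym h) (trans eq h′))))

  separate : ∀ k k′ → Distinct k k′ → Separated k k′
  separate (vertex x) (vertex y) x≢y =
    separatedVia (inj₁ x) (inj₁ y) x≢y λ _ ne → ne ∘ 2*-injective
  separate (vertex x) (subdivision e) _ =
    separatedVia (inj₁ x) (inj₂ (toEdge e)) (λ ()) λ w _ → even≢odd (dG x w) (dEV e w)
  separate (subdivision e) (vertex x) _ = Separated-sym (separate (vertex x) (subdivision e) tt)
  separate (subdivision e) (subdivision f) e≢f =
    separatedVia (inj₂ (toEdge e)) (inj₂ (toEdge f)) (≢⇒¬SameEdge e f e≢f) λ _ ne → ne ∘ 2*-injective ∘ suc-injective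
  separate (vertex x) (half y e p) _ = separate-vertex-half x y e p
  separate (half y e p) (vertex x) _ = Separated-sym (separate-vertex-half x y e p)
  separate (subdivision f) (half y e p) _ = separate-subdivision-half f y e p
  separate (half y e p) (subdivision f) _ = Separated-sym (separate-subdivision-half f y e p)
  separate (half x e p) (half y f q) ¬same = separate-half-half x e p y f q ¬same

  mixed-lift : Metric.MixedResolvingSet (SAdj G) (map inj₁ S)
  mixed-lift z z′ ¬same with separate (classify z) (classify z′) (distinct z z′ ¬same)
  ... | separatedAt {w} w∈S ne = inj₁ w , ∈-map⁺ inj₁ w∈S , Sd.≢⇒Resolves (inj₁ w) z z′ λ eq →
        ne (trans (sym (distanceFrom-classify z w)) (trans eq (distanceFrom-classify z′ w)))


corollary3p2 : ∀ {n : ℕ} (G : SimpleGraph n) → ConnectedG G →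
    ∀ (d ed p ms mg : ℕ) →
    Metric.IsDim (Adj G) d → Metric.IsEdim (Adj G) ed → IsPhi G p →
    Metric.IsMdim (SAdj G) ms → Metric.IsMdim (Adj G) mg →
    (d ⊔ ed ≤ p) × (p ≤ 2 * ms) × (ms ≤ mg)
corollary3p2 G conn d ed p ms mg isDim isEdim
  ((X , (_ , resX , minX) , (L , uL , lenL , L≈φX)) , _)
  isMdimS@((M , uM , mixM , lenM) , _) ((S , uS , mixS , lenS) , _) =
    ⊔-lub (subst (d ≤_) lenL (proj₂ isDim L uL φ-resolving))
          (subst (ed ≤_) lenL (proj₂ isEdim L uL φ-edgeResolving)) ,
    subst (_≤ 2 * ms) lenL (begin
      length L               ≤⟨ Unique-length-mono uL (InPhi⇒∈endpoints X ∘ proj₁ (L≈φX _)) ⟩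
      length (endpoints X)   ≤⟨ length-endpoints X ⟩
      2 * length X           ≤⟨ *-monoʳ-≤ 2 (minX M uM (mixed⇒resolving mixM)) ⟩
      2 * length M           ≡⟨ cong (2 *_) lenM ⟩
      2 * ms                 ∎) ,
    subst (ms ≤_) (trans (length-map inj₁ S) lenS)
      (proj₂ isMdimS (map inj₁ S) (Unique.map⁺ inj₁-injective uS) (mixed-lift G conn mixS))
  where
  open ≤-Reasoning
  open PhiResolving G conn resX (λ u → proj₂ (L≈φX u))
  open Endpoints G
  open MixedLift using (mixed-lift)
  open WalkDistance (SAdj G) using (mixed⇒resolving)
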